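{- If a dependency $\mathbf D$ is domain independent, then it is relativizable.
   Context: Team semantics: for a first order model $\mathcal M$ with domain $M$, a team $X$ is a set of assignments $s: V\to M$; $X(\vec v)=\{s(\vec v): s\in X\}$. Formulas are in negation normal form; $\mathcal M\models_X\phi$: literals hold at every $s\in X$ (Tarskian sense); $\phi_1\vee\phi_2$ iff $X=Y\cup Z$ with $Y\models\phi_1$, $Z\models\phi_2$; $\wedge$ componentwise; $\exists v\psi$ iff some $H:X\to\mathcal P(M)\setminus\{\emptyset\}$ has $\mathcal M\models_{X[H/v]}\psi$ with $X[H/v]=\{s[m/v]:s\in X,m\in H(s)\}$; $\forall v\psi$ iff $\mathcal M\models_{X[M/v]}\psi$ with $X[M/v]=\{s[m/v]:s\in X,m\in M\}$. A sentence is true in $\mathcal M$ iff satisfied by $\{\epsilon\}$. A $k$-ary dependency $\mathbf D$ is a class, closed under isomorphism, of structures $(A,R)$ with $R\subseteq A^k$; the atom $\mathbf D\vec x$ holds in $X$ iff $(M,X(\vec x))\in\mathbf D$. $\mathbf D$ is domain independent if $(A,R)\in\mathbf D\iff(\mathrm{Fld}(R),R)\in\mathbf D$, with $\mathrm{Fld}(R)$ the set of elements occurring in tuples of $R$. Relativization: fix a unary predicate symbol $P$; for models $\mathcal M$ whose signature contains $P$, the relativized atom is defined by $\mathcal M\models_X\mathbf D^{(P)}\vec x$ iff $(P^{\mathcal M},X(\vec x))\in\mathbf D$ (this requires $X(\vec x)\subseteq (P^{\mathcal M})^{|\vec x|}$). $\mathbf D$ is relativizable if every sentence of $\mathbf{FO}(\mathbf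 D^{(P)})$ (first order logic with team semantics plus the relativized atoms, for fixed $P$) is equivalent to some sentence of $\mathbf{FO}(\mathbf D)$. -}

module Defs where

open import Level using (Level; 0ℓ) renaming (suc to lsuc)
open import Data.Nat using (ℕ; zero; suc)
open import Data.Fin using (Fin)
open import Data.Vec using (Vec; []; _∷_; lookup; map)
open import Data.Vec.Relation.Binary.Pointwise.Inductive using (Pointwise; []; _∷_)
open import Data.Vec.Relation.Unary.Any using (Any)
open import Data.Vec.Relation.Unary.All using (All)
open import Data.Product using (Σ; ∃; _×_; _,_; proj₁; proj₂)
open import Data.Sum using (_⊎_)
open import Data.Unit using (⊤)
open import Relation.Nullary using (¬_)
open import Relation.Binary using (Setoid)
open import Function.Bundles using (Bijection; _⇔_)
import Relation.Binary.Construct.On as On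

-- Domains are setoids (so that subdomains such as Fld(R) and P^M are
-- honest subsets, identified up to the setoid equality); a k-ary relation
-- is a predicate on k-tuples that respects the setoid equality.

module _ (A : Setoid 0ℓ 0ℓ) where
  open Setoid A renaming (Carrier to C)

  _≈ᵥ_ : ∀ {k} → Vec C k → Vec C k → Set
  _≈ᵥ_ = Pointwise _≈_

  record RelOn (k : ℕ) : Set₁ where
    field
      rel  : Vec C k → Set
      resp : ∀ {t t′} → t ≈ᵥ t′ → rel t → rel t′

open RelOn public

Sub : (A : Setoid 0ℓ 0ℓ) → (Setoid.Carrier A → Set) → Setoid 0ℓ 0ℓ
Sub A U = On.setoid A (proj₁ {B = U})

mapProj-≈ : (A : Setoid 0ℓ 0ℓ) (U : Setoid.Carrier A → Set) {k : ℕ}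
  {t t′ : Vec (Σ (Setoid.Carrier A) U) k} →
  _≈ᵥ_ (Sub A U) t t′ → _≈ᵥ_ A (map proj₁ t) (map proj₁ t′)
mapProj-≈ A U [] = []
mapProj-≈ A U (e ∷ es) = e ∷ mapProj-≈ A U es

-- Restriction of a relation on A to a subdomain U ⊆ A
-- (only meaningful when R ⊆ U^k, as in the uses below).
restrict : (A : Setoid 0ℓ 0ℓ) (U : Setoid.Carrier A → Set) {k : ℕ} →
  RelOn A k → RelOn (Sub A U) k
restrict A U R = record
  { rel  = λ t → rel R (map proj₁ t)
  ; resp = λ e → resp R (mapProj-≈ A U e) }

InFld : (A : Setoid 0ℓ 0ℓ) {k : ℕ} → RelOn A k → Setoid.Carrier A → Set
InFld A R a = ∃ λ t → rel R t × Any (Setoid._≈_ A a) t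

Fld : (A : Setoid 0ℓ 0ℓ) {k : ℕ} → RelOn A k → Setoid 0ℓ 0ℓ
Fld A R = Sub A (InFld A R)

FldRel : (A : Setoid 0ℓ 0ℓ) {k : ℕ} (R : RelOn A k) → RelOn (Fld A R) k
FldRel A R = restrict A (InFld A R) R

record Dependency (k : ℕ) : Set₂ where
  field
    _∈D_ : (A : Setoid 0ℓ 0ℓ) → RelOn A k → Set₁
    iso-closed : (A B : Setoid 0ℓ 0ℓ) (R : RelOn A k) (R′ : RelOn B k)
      (f : Bijection A B) →
      (∀ t → rel R t ⇔ rel R′ (map (Bijection.to f) t)) →
      A ∈D R → B ∈D R′

open Dependency public

DomainIndependent : ∀ {k} → Dependency k → Set₁
DomainIndependent {k} D =
  (A : Setoid 0ℓ 0ℓ) (R : RelOn A k) → _∈D_ D A R ⇔ _∈D_ D (Fld A R) (FldRel A R)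

record Signature : Set₁ where
  field
    RelSym : ℕ → Set
    FunSym : ℕ → Set

open Signature public

record Structure (σ : Signature) : Set₁ where
  field
    dom   : Setoid 0ℓ 0ℓ
    point : Setoid.Carrier dom
    relI  : ∀ {m} → RelSym σ m → RelOn dom m
    funI  : ∀ {m} → FunSym σ m → Vec (Setoid.Carrier dom) m → Setoid.Carrier dom
    funI-cong : ∀ {m} (f : FunSym σ m) {t t′} →
      _≈ᵥ_ dom t t′ → Setoid._≈_ dom (funI f t) (funI f t′)

open Structure public

data Term (σ : Signature) (n : ℕ) : Set where
  var : Fin n → Term σ n
  app : ∀ {m} → FunSym σ m → Vec (Term σ n) m → Term σ n

module _ {σ : Signature} (M : Structure σ) where
  private C = Setoid.Carrier (dom M)

  mutual
    evalT : ∀ {n} → Vec C n → Term σ n → C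
    evalT s (var x)    = lookup s x
    evalT s (app f ts) = funI M f (evalTs s ts)

    evalTs : ∀ {n m} → Vec C n → Vec (Term σ n) m → Vec C m
    evalTs s []       = []
    evalTs s (t ∷ ts) = evalT s t ∷ evalTs s ts

-- The same syntax serves FO(D) and FO(D^(P)); the atom is read as D or
-- as D^(P) according to the semantics used.

data Fm (σ : Signature) (k : ℕ) : ℕ → Set where
  rel⁺ : ∀ {n m} → RelSym σ m → Vec (Term σ n) m → Fm σ k n
  rel⁻ : ∀ {n m} → RelSym σ m → Vec (Term σ n) m → Fm σ k n
  eq⁺  : ∀ {n} → Term σ n → Term σ n → Fm σ k n
  eq⁻  : ∀ {n} → Term σ n → Term σ n → Fm σ k n
  dep  : ∀ {n} → Vec (Fin n) k → Fm σ k n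
  _∨_  : ∀ {n} → Fm σ k n → Fm σ k n → Fm σ k n
  _∧_  : ∀ {n} → Fm σ k n → Fm σ k n → Fm σ k n
  ∃'   : ∀ {n} → Fm σ k (suc n) → Fm σ k n
  ∀'   : ∀ {n} → Fm σ k (suc n) → Fm σ k n

module _ {σ : Signature} (M : Structure σ) where
  private
    A = dom M
    C = Setoid.Carrier A
    open Setoid A using (_≈_)

  record Team (n : ℕ) : Set₁ where
    field
      mem  : Vec C n → Set
      memResp : ∀ {s s′} → _≈ᵥ_ A s s′ → mem s → mem s′

  open Team public

  teamRel : ∀ {n k} → Team n → Vec (Fin n) k → RelOn A k
  teamRel X xs = record
    { rel  = λ t → ∃ λ s → mem X s × _≈ᵥ_ A (map (lookup s) xs) t
    ; resp = λ e (s , m , e′) → s , m , Data.Vec.Relation.Binary.Pointwise.Inductive.trans (Setoid.trans A) e′ e }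

  allExt : ∀ {n} → Team n → Team (suc n)
  allExt X = record
    { mem = λ { (m ∷ s) → mem X s }
    ; memResp = λ { (_ ∷ e) p → memResp X e p } }

  supExt : ∀ {n} → Team n → (Vec C n → C → Set) → Team (suc n)
  supExt X H = record
    { mem = λ s′ → ∃ λ s → ∃ λ m → mem X s × H s m × _≈ᵥ_ A (m ∷ s) s′
    ; memResp = λ e (s , m , p , h , e′) → s , m , p , h ,
        Data.Vec.Relation.Binary.Pointwise.Inductive.trans (Setoid.trans A) e′ e }

  data Mode : Set where
    plain : Mode
    relativized : RelSym σ 1 → Mode

  private
    PDom : RelSym σ 1 → C → Set
    PDom P a = rel (relI M P) (a ∷ [])

  depSat : ∀ {n k} → Dependency k → Mode → Team n → Vec (Fin n) k → Set₁
  depSat D plain X xs = _∈D_ D A (teamRel X xs)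
  depSat D (relativized P) X xs =
    Σ (∀ t → rel (teamRel X xs) t → All (PDom P) t) λ _ →
      _∈D_ D (Sub A (PDom P)) (restrict A (PDom P) (teamRel X xs))

  sat : ∀ {n k} → Dependency k → Mode → Fm σ k n → Team n → Set₁
  sat D md (rel⁺ R ts) X = Level.Lift (lsuc 0ℓ) (∀ s → mem X s → rel (relI M R) (evalTs M s ts))
  sat D md (rel⁻ R ts) X = Level.Lift (lsuc 0ℓ) (∀ s → mem X s → ¬ rel (relI M R) (evalTs M s ts))
  sat D md (eq⁺ t u) X = Level.Lift (lsuc 0ℓ) (∀ s → mem X s → evalT M s t ≈ evalT M s u)
  sat D md (eq⁻ t u) X = Level.Lift (lsuc 0ℓ) (∀ s → mem X s → ¬ (evalT M s t ≈ evalT M s u))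
  sat D md (dep xs) X = depSat D md X xs
  sat D md (φ ∨ ψ) X = ∃ λ (Y : Team _) → ∃ λ (Z : Team _) →
    Level.Lift (lsuc 0ℓ) (∀ s → mem X s ⇔ (mem Y s ⊎ mem Z s)) × sat D md φ Y × sat D md ψ Z
  sat D md (φ ∧ ψ) X = sat D md φ X × sat D md ψ X
  sat D md (∃' φ) X = ∃ λ (H : Vec C _ → C → Set) →
    Level.Lift (lsuc 0ℓ) (∀ s → mem X s → ∃ λ m → H s m) × sat D md φ (supExt X H)
  sat D md (∀' φ) X = sat D md φ (allExt X)

  εTeam : Team 0
  εTeam = record { mem = λ _ → ⊤ ; memResp = λ _ p → p }

  true : ∀ {k} → Dependency k → Mode → Fm σ k 0 → Set₁
  true D md φ = sat D md φ εTeam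

Relativizable : ∀ {k} → Dependency k → Set₁
Relativizable {k} D =
  (σ : Signature) (P : RelSym σ 1) (φ : Fm σ k 0) →
  Σ (Fm σ k 0) λ ψ → (M : Structure σ) →
    true M D (relativized P) φ ⇔ true M D plain ψ

{-# OPTIONS --safe #-}
-- A formula of FO(D^(P)) is translated by guarding every dependency atom
-- D x⃗ with the first-order conjuncts P x₁ ∧ … ∧ P xₖ.  The guard forces
-- X(x⃗) ⊆ (P^M)^k, and then (P^M , X(x⃗)) ∈ D ⇔ (M , X(x⃗)) ∈ D because both
-- structures have the same field: Fld X(x⃗) computed inside P^M or inside M
-- gives isomorphic structures, so domain independence and closure under
-- isomorphism connect the two sides.  All other connectives translate
-- homomorphically, since their team semantics does not refer to the domain
-- of the dependency atom.
module Submission where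

open import Defs

open import Level using (0ℓ; lift)
open import Data.Nat using (ℕ)
open import Data.Fin using (Fin; zero)
open import Data.Vec using (Vec; []; _∷_; lookup; map)
open import Data.Vec.Properties using (map-∘)
open import Data.Vec.Relation.Binary.Pointwise.Inductive using ([]; _∷_)
import Data.Vec.Relation.Binary.Pointwise.Inductive as Pointwise
open import Data.Vec.Relation.Unary.Any using (Any; here; there)
open import Data.Vec.Relation.Unary.All using (All; []; _∷_; lookupₛ)
import Data.Vec.Relation.Unary.All as All
open import Data.Product using (Σ; _,_; proj₁)
open import Relation.Binary using (Setoid)
open import Relation.Binary.PropositionalEquality using (_≡_; refl; cong; subst; sym; trans)
open import Function.Bundles using (Bijection; _⇔_; mk⇔; Equivalence)
import Function.Properties.Equivalence as ⇔
open import Function using (id)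

open Equivalence

module _ (A : Setoid 0ℓ 0ℓ) {U : Setoid.Carrier A → Set}
  (U-resp : ∀ {a b} → Setoid._≈_ A a b → U a → U b) where
  open Setoid A using (_≈_) renaming (Carrier to C)

  attach : ∀ {m} (t : Vec C m) → All U t → Vec (Σ C U) m
  attach [] [] = []
  attach (a ∷ t) (u ∷ us) = (a , u) ∷ attach t us

  map-proj₁-attach : ∀ {m} (t : Vec C m) (us : All U t) → map proj₁ (attach t us) ≡ t
  map-proj₁-attach [] [] = refl
  map-proj₁-attach (a ∷ t) (u ∷ us) = cong (a ∷_) (map-proj₁-attach t us)

  any-attach : ∀ {a m} {t : Vec C m} (us : All U t) → Any (a ≈_) t →
    Any (λ b → a ≈ proj₁ b) (attach t us)
  any-attach (u ∷ us) (here e) = here e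
  any-attach (u ∷ us) (there i) = there (any-attach us i)

  any-map-proj₁ : ∀ {a m} {t : Vec (Σ C U) m} → Any (λ b → a ≈ proj₁ b) t →
    Any (a ≈_) (map proj₁ t)
  any-map-proj₁ (here e) = here e
  any-map-proj₁ (there i) = there (any-map-proj₁ i)

  module _ {k : ℕ} (R : RelOn A k) (R⊆Uᵏ : ∀ t → rel R t → All U t) where
    private
      R↾U = restrict A U R
      Fld↾U = Fld (Sub A U) R↾U

    fld-to : Setoid.Carrier (Fld A R) → Setoid.Carrier Fld↾U
    fld-to (a , t , r , i) =
      (a , lookupₛ A U-resp us i) ,
      attach t us , subst (rel R) (sym (map-proj₁-attach t us)) r , any-attach us i
      where us = R⊆Uᵏ t r

    fld-from : Setoid.Carrier Fld↾U → Setoid.Carrier (Fld A R)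
    fld-from ((a , _) , t , r , i) = a , map proj₁ t , r , any-map-proj₁ i

    -- Both maps preserve the underlying element of A, which is all the
    -- setoid equalities of the two fields compare.
    fld-to-bijection : Bijection (Fld A R) Fld↾U
    fld-to-bijection = record { to = fld-to ; cong = id ; bijective = id , λ y → fld-from y , id }

    fld-from-bijection : Bijection Fld↾U (Fld A R)
    fld-from-bijection = record { to = fld-from ; cong = id ; bijective = id , λ y → fld-to y , id }

    map-fld-to : ∀ {m} (t : Vec (Setoid.Carrier (Fld A R)) m) →
      map proj₁ (map proj₁ (map fld-to t)) ≡ map proj₁ t
    map-fld-to t = trans (sym (map-∘ proj₁ proj₁ (map fld-to t))) (sym (map-∘ _ fld-to t))

    map-fld-from : ∀ {m} (t : Vec (Setoid.Carrier Fld↾U) m) →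
      map proj₁ (map fld-from t) ≡ map proj₁ (map proj₁ t)
    map-fld-from t = trans (sym (map-∘ proj₁ fld-from t)) (map-∘ proj₁ proj₁ t)

    ∈D-restrict : (D : Dependency k) → DomainIndependent D →
      _∈D_ D A R ⇔ _∈D_ D (Sub A U) R↾U
    ∈D-restrict D di = ⇔.trans (di A R) (⇔.trans fields-iso (⇔.sym (di (Sub A U) R↾U)))
      where
      fields-iso : _∈D_ D (Fld A R) (FldRel A R) ⇔ _∈D_ D Fld↾U (FldRel (Sub A U) R↾U)
      fields-iso = mk⇔
        (iso-closed D _ _ _ _ fld-to-bijection λ t →
          mk⇔ (subst (rel R) (sym (map-fld-to t))) (subst (rel R) (map-fld-to t)))
        (iso-closed D _ _ _ _ fld-from-bijection λ t →
          mk⇔ (subst (rel R) (sym (map-fld-from t))) (subst (rel R) (map-fld-from t)))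

module _ {σ : Signature} (P : RelSym σ 1) where

  -- The bound variable makes this available also for sentences (n = 0).
  tautology : ∀ {k n} → Fm σ k n
  tautology = ∀' (eq⁺ (var zero) (var zero))

  allInP : ∀ {k n m} → Vec (Fin n) m → Fm σ k n
  allInP [] = tautology
  allInP (x ∷ xs) = rel⁺ P (var x ∷ []) ∧ allInP xs

  relativize : ∀ {k n} → Fm σ k n → Fm σ k n
  relativize (rel⁺ R ts) = rel⁺ R ts
  relativize (rel⁻ R ts) = rel⁻ R ts
  relativize (eq⁺ t u) = eq⁺ t u
  relativize (eq⁻ t u) = eq⁻ t u
  relativize (dep xs) = allInP xs ∧ dep xs
  relativize (φ ∨ ψ) = relativize φ ∨ relativize ψ
  relativize (φ ∧ ψ) = relativize φ ∧ relativize ψ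
  relativize (∃' φ) = ∃' (relativize φ)
  relativize (∀' φ) = ∀' (relativize φ)

  module _ (M : Structure σ) where
    open Setoid (dom M) using (_≈_) renaming (Carrier to C)

    Pᴹ : C → Set
    Pᴹ a = rel (relI M P) (a ∷ [])

    Pᴹ-resp : ∀ {a b} → a ≈ b → Pᴹ a → Pᴹ b
    Pᴹ-resp e = resp (relI M P) (e ∷ [])

    All-Pᴹ-resp : ∀ {m} {t t′ : Vec C m} → _≈ᵥ_ (dom M) t t′ → All Pᴹ t → All Pᴹ t′
    All-Pᴹ-resp [] [] = []
    All-Pᴹ-resp (e ∷ es) (u ∷ us) = Pᴹ-resp e u ∷ All-Pᴹ-resp es us

    sat-allInP : ∀ {k n m} (D : Dependency k) (md : Mode M) (xs : Vec (Fin n) m) (X : Team M n) →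
      sat M D md (allInP xs) X ⇔ (∀ s → mem X s → All Pᴹ (map (lookup s) xs))
    sat-allInP D md [] X = mk⇔ (λ _ _ _ → []) (λ _ → lift λ _ _ → Setoid.refl (dom M))
    sat-allInP D md (x ∷ xs) X = mk⇔
      (λ (lift h , hs) s m → h s m ∷ to (sat-allInP D md xs X) hs s m)
      (λ h → lift (λ s m → All.head (h s m)) ,
             from (sat-allInP D md xs X) λ s m → All.tail (h s m))

    assignments⇔teamRel : ∀ {n k} (X : Team M n) (xs : Vec (Fin n) k) →
      (∀ s → mem X s → All Pᴹ (map (lookup s) xs)) ⇔ (∀ t → rel (teamRel M X xs) t → All Pᴹ t)
    assignments⇔teamRel X xs = mk⇔
      (λ h t (s , m , e) → All-Pᴹ-resp e (h s m))
      (λ h s m → h _ (s , m , Pointwise.refl (Setoid.refl (dom M))))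

    module _ {k} (D : Dependency k) (di : DomainIndependent D) where

      sat-relativize-dep : ∀ {n} (xs : Vec (Fin n) k) (X : Team M n) →
        sat M D (relativized P) (dep xs) X ⇔ sat M D plain (relativize (dep xs)) X
      sat-relativize-dep xs X = mk⇔
        (λ (inP , d) → from guard inP , from (∈D-relativized inP) d)
        (λ (g , d) → to guard g , to (∈D-relativized (to guard g)) d)
        where
        guard = ⇔.trans (sat-allInP D plain xs X) (assignments⇔teamRel X xs)
        ∈D-relativized = λ inP → ∈D-restrict (dom M) Pᴹ-resp (teamRel M X xs) inP D di

      sat-relativize : ∀ {n} (φ : Fm σ k n) (X : Team M n) →
        sat M D (relativized P) φ X ⇔ sat M D plain (relativize φ) X
      sat-relativize (rel⁺ R ts) X = ⇔.refl
      sat-relativize (rel⁻ R ts) X = ⇔.refl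
      sat-relativize (eq⁺ t u) X = ⇔.refl
      sat-relativize (eq⁻ t u) X = ⇔.refl
      sat-relativize (dep xs) X = sat-relativize-dep xs X
      sat-relativize (φ ∨ ψ) X = mk⇔
        (λ (Y , Z , c , a , b) → Y , Z , c , to (sat-relativize φ Y) a , to (sat-relativize ψ Z) b)
        (λ (Y , Z , c , a , b) → Y , Z , c , from (sat-relativize φ Y) a , from (sat-relativize ψ Z) b)
      sat-relativize (φ ∧ ψ) X = mk⇔
        (λ (a , b) → to (sat-relativize φ X) a , to (sat-relativize ψ X) b)
        (λ (a , b) → from (sat-relativize φ X) a , from (sat-relativize ψ X) b)
      sat-relativize (∃' φ) X = mk⇔
        (λ (H , c , a) → H , c , to (sat-relativize φ (supExt M X H)) a)
        (λ (H , c , a) → H , c , from (sat-relativize φ (supExt M X H)) a)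
      sat-relativize (∀' φ) X = sat-relativize φ (allExt M X)

proposition6 : ∀ {k} (D : Dependency k) → DomainIndependent D → Relativizable D
proposition6 D di σ P φ = relativize P φ , λ M → sat-relativize P M D di φ (εTeam M)
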